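{- Let $P$ be a finite poset and let $C$ be a nonempty connected downset of the subposet $M_P$. Then $\sum_{x\in C}\mu_{\widehat P}(x)=-1$ if and only if $C$ is a tree.
   Context: $M_P=\{x\in P: \text{every } y \text{ covered by } x \text{ is minimal in } P\}$ (this includes all minimal elements), regarded as an induced subposet. "Connected" and "tree" refer to the subgraph of the undirected Hasse diagram induced on $C$. $\widehat P$ is $P$ with a new minimum $\hat0$ adjoined, and $\mu_{\widehat P}$ is defined recursively by $\sum_{y\le x}\mu_{\widehat P}(y)=\delta_{\hat0,x}$ for $x\in\widehat P$. -}

module Defs where

open import Data.Nat using (ℕ; zero; suc; _≥_)
open import Data.Fin using (Fin; zero; suc)
open import Data.Fin.Subset using (Subset; _∈_; _∉_)
open import Data.Fin.Subset.Properties using (_∈?_)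
open import Data.Integer using (ℤ; _+_; 0ℤ; 1ℤ)
open import Data.Maybe using (Maybe; nothing; just)
open import Data.List using (List; []; _∷_; _++_; length; [_])
open import Data.List.Relation.Unary.All using (All)
open import Data.List.Relation.Unary.Linked using (Linked)
open import Data.List.Relation.Unary.Unique.Propositional using (Unique)
open import Data.Product using (Σ; ∃; _×_; _,_)
open import Data.Sum using (_⊎_)
open import Data.Bool using (if_then_else_)
open import Data.Empty using (⊥)
open import Data.Unit using (⊤)
open import Function using (_∘_)
open import Relation.Nullary using (¬_; Dec; yes; no)
open import Relation.Nullary.Decidable using (⌊_⌋)
open import Relation.Binary.Structures using (IsDecPartialOrder)
open import Relation.Binary.PropositionalEquality using (_≡_)

sumFin : ∀ {m} → (Fin m → ℤ) → ℤ
sumFin {zero}  f = 0ℤ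
sumFin {suc m} f = f zero + sumFin (f ∘ suc)

-- A finite poset: carrier Fin n with a decidable partial order.
-- (Every finite poset is isomorphic to one of this form.)
record FinPoset : Set₁ where
  field
    n     : ℕ
    _≼_   : Fin n → Fin n → Set
    isDPO : IsDecPartialOrder _≡_ _≼_

module Notions (P : FinPoset) where
  open FinPoset P public
  open IsDecPartialOrder isDPO using (_≤?_)

  _≺_ : Fin n → Fin n → Set
  x ≺ y = x ≼ y × ¬ (x ≡ y)

  _⋖_ : Fin n → Fin n → Set
  y ⋖ x = y ≺ x × (∀ z → ¬ (y ≺ z × z ≺ x))

  Minimal : Fin n → Set
  Minimal y = ∀ z → z ≼ y → z ≡ y

  InM : Fin n → Set
  InM x = ∀ y → y ⋖ x → Minimal y

  IsDownsetOfM : Subset n → Set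
  IsDownsetOfM C = (∀ x → x ∈ C → InM x)
                 × (∀ x y → x ∈ C → InM y → y ≼ x → y ∈ C)

  Adj : Subset n → Fin n → Fin n → Set
  Adj C x y = x ∈ C × y ∈ C × (x ⋖ y ⊎ y ⋖ x)

  data Path (C : Subset n) : Fin n → Fin n → Set where
    here : ∀ {x} → x ∈ C → Path C x x
    step : ∀ {x y z} → Adj C x y → Path C y z → Path C x z

  Connected : Subset n → Set
  Connected C = ∀ x y → x ∈ C → y ∈ C → Path C x y

  HasCycle : Subset n → Set
  HasCycle C = Σ (Fin n) λ v → Σ (List (Fin n)) λ vs →
                 length (v ∷ vs) ≥ 3 × Unique (v ∷ vs) ×
                 Linked (Adj C) (v ∷ vs ++ [ v ])

  IsTree : Subset n → Set
  IsTree C = Connected C × ¬ HasCycle C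

  -- P̂ = P with a new minimum 0̂ (= nothing)
  P̂ : Set
  P̂ = Maybe (Fin n)

  _≼̂_ : P̂ → P̂ → Set
  nothing ≼̂ y       = ⊤
  just x  ≼̂ nothing = ⊥
  just x  ≼̂ just y  = x ≼ y

  _≼̂?_ : (x y : P̂) → Dec (x ≼̂ y)
  nothing ≼̂? y       = yes _
  just x  ≼̂? nothing = no (λ ())
  just x  ≼̂? just y  = x ≤? y

  sumP̂ : (P̂ → ℤ) → ℤ
  sumP̂ f = f nothing + sumFin (f ∘ just)

  δ0̂ : P̂ → ℤ
  δ0̂ nothing  = 1ℤ
  δ0̂ (just _) = 0ℤ

  IsMobius : (P̂ → ℤ) → Set
  IsMobius μ = ∀ x → sumP̂ (λ y → if ⌊ y ≼̂? x ⌋ then μ y else 0ℤ) ≡ δ0̂ x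

  sumOver : Subset n → (P̂ → ℤ) → ℤ
  sumOver C μ = sumFin (λ x → if ⌊ x ∈? C ⌋ then μ (just x) else 0ℤ)

-- For x ∈ M_P every element strictly below x is minimal, and minimal elements have μ = −1, so the
-- Möbius recursion gives μ(x) = #{y : y < x} − 1. If x moreover lies in a downset C of M_P, the
-- elements below x are exactly its lower covers, and they lie in C. Summing over C therefore gives
-- Σ_{x ∈ C} μ(x) = E − V, where V and E count the vertices and edges of the Hasse diagram on C.
-- A connected graph has E ≥ V − 1, with equality iff it has no cycle: build C from one vertex by
-- repeatedly adding a vertex v adjacent to the part S already built. This adds deg_S v ≥ 1 edges;
-- a cycle through v forces deg_S v ≥ 2, and if no cycle arises then deg_S v = 1, since two
-- neighbours of v in S would be joined by a simple path in S that closes up into a cycle.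

module Submission where

open import Defs

open import Algebra.Bundles using (CommutativeMonoid)
open import Data.Nat using (ℕ; zero; suc; _+_; _*_; _≤_; _<_; z≤n; s≤s; s≤s⁻¹)
open import Data.Nat.Properties
  using ( +-0-commutativeMonoid; +-assoc; +-comm; +-identityʳ; +-suc; *-identityˡ; *-identityʳ
        ; *-distribˡ-+; *-distribʳ-+; ≤-refl; ≤-reflexive; ≤-trans; ≤-antisym; <-≤-trans; <⇒≱
        ; m≤m+n; m≤n+m; m+1+n≰m; +-mono-≤; +-monoˡ-≤; +-monoʳ-≤; +-mono-<-≤; +-mono-≤-<
        ; module ≤-Reasoning )
open import Data.Fin using (Fin; zero; suc)
open import Data.Fin.Properties using (suc-injective; 0≢1+n; _≟_; any?; all?)
open import Data.Product using (Σ; ∃; _×_; _,_; proj₁; proj₂)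
open import Data.Sum using (_⊎_; inj₁; inj₂)
open import Data.Empty using (⊥; ⊥-elim)
open import Function using (_∘_; _⇔_; mk⇔; Equivalence)
open import Function.Construct.Composition using (_⇔-∘_)
open import Relation.Nullary using (¬_; ¬?; Dec; yes; no; _×-dec_; _⊎-dec_)
open import Relation.Unary using (Decidable)
open import Data.Fin.Subset
  using (Subset; Nonempty; _∈_; _∉_; _∪_; ⁅_⁆; _⊆_; ∣_∣) renaming (⊥ to ∅)
open import Data.Fin.Subset.Properties
  using ( _∈?_; x∈p∪q⁻; x∈p∪q⁺; x∈⁅x⁆; x∈⁅y⁆⇒x≡y; ∉⊥; p⊆p∪q; ⊆-antisym
        ; p⊂q⇒∣p∣<∣q∣; ∣p∣≤n )
open import Data.List using (List; []; _∷_; _++_; _∷ʳ_; length; [_]; initLast; _∷ʳ′_)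
open import Data.List.Properties using (++-assoc; ++-identityʳ; length-++)
open import Data.List.Membership.Propositional using () renaming (_∈_ to _∈ₗ_)
open import Data.List.Membership.Propositional.Properties using (∈-∃++; ∈-++⁺ʳ)
open import Data.List.Relation.Unary.All as All using (All; []; _∷_)
open import Data.List.Relation.Unary.All.Properties using (¬Any⇒All¬) renaming (++⁺ to All-++⁺)
open import Data.List.Relation.Unary.Any using (here; there) renaming (any? to anyₗ?)
open import Data.List.Relation.Unary.AllPairs using ([]; _∷_)
open import Data.List.Relation.Unary.Linked as Linked using (Linked; []; [-]; _∷_)
open import Data.List.Relation.Unary.Unique.Propositional using (Unique)
open import Data.Maybe using (nothing; just)
open import Data.Bool using (if_then_else_)
open import Relation.Nullary.Decidable using (⌊_⌋)
open import Relation.Binary.Structures using (IsDecPartialOrder)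
open import Relation.Binary.PropositionalEquality
  using (_≡_; _≢_; refl; sym; trans; cong; cong₂; subst; subst₂; module ≡-Reasoning)

module FinSum {c ℓ} (M : CommutativeMonoid c ℓ) where
  open CommutativeMonoid M
    using (Carrier; _≈_; _∙_; ε; ∙-cong; ∙-congˡ; ∙-congʳ; identityˡ; identityʳ; setoid)
    renaming (refl to ≈-refl; trans to ≈-trans)
  open import Algebra.Properties.CommutativeMonoid.Sum M public
  open import Relation.Binary.Reasoning.Setoid setoid

  sum-zero : ∀ {n} (f : Fin n → Carrier) → (∀ i → f i ≈ ε) → sum f ≈ ε
  sum-zero {zero}  f f≈ε = ≈-refl
  sum-zero {suc n} f f≈ε =
    ≈-trans (∙-cong (f≈ε zero) (sum-zero (f ∘ suc) (f≈ε ∘ suc))) (identityˡ ε)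

  sum-single : ∀ {n} (f : Fin n → Carrier) a → (∀ i → i ≢ a → f i ≈ ε) → sum f ≈ f a
  sum-single f zero    f≈ε = begin
    f zero ∙ sum (f ∘ suc) ≈⟨ ∙-congˡ (sum-zero (f ∘ suc) (λ i → f≈ε (suc i) λ ())) ⟩
    f zero ∙ ε             ≈⟨ identityʳ (f zero) ⟩
    f zero                 ∎
  sum-single f (suc a) f≈ε = begin
    f zero ∙ sum (f ∘ suc) ≈⟨ ∙-congʳ (f≈ε zero λ ()) ⟩
    ε ∙ sum (f ∘ suc)      ≈⟨ identityˡ _ ⟩
    sum (f ∘ suc)          ≈⟨ sum-single (f ∘ suc) a (λ i → f≈ε (suc i) ∘ (_∘ suc-injective)) ⟩
    f (suc a)              ∎

module ℕΣ = FinSum +-0-commutativeMonoid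
open ℕΣ using (sum)

sum-mono-≤ : ∀ {n} {f g : Fin n → ℕ} → (∀ i → f i ≤ g i) → sum f ≤ sum g
sum-mono-≤ {zero}  f≤g = z≤n
sum-mono-≤ {suc n} f≤g = +-mono-≤ (f≤g zero) (sum-mono-≤ (f≤g ∘ suc))

sum-mono-< : ∀ {n} {f g : Fin n → ℕ} → (∀ i → f i ≤ g i) → ∀ a → f a < g a → sum f < sum g
sum-mono-< f≤g zero    fa<ga = +-mono-<-≤ fa<ga (sum-mono-≤ (f≤g ∘ suc))
sum-mono-< f≤g (suc a) fa<ga = +-mono-≤-< (f≤g zero) (sum-mono-< (f≤g ∘ suc) a fa<ga)

term≤sum : ∀ {n} (f : Fin n → ℕ) a → f a ≤ sum f
term≤sum f zero    = m≤m+n _ _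
term≤sum f (suc a) = ≤-trans (term≤sum (f ∘ suc) a) (m≤n+m _ (f zero))

two-terms≤sum : ∀ {n} (f : Fin n → ℕ) {a b} → a ≢ b → f a + f b ≤ sum f
two-terms≤sum f {zero}  {zero}  a≢b = ⊥-elim (a≢b refl)
two-terms≤sum f {zero}  {suc b} a≢b = +-monoʳ-≤ (f zero) (term≤sum (f ∘ suc) b)
two-terms≤sum f {suc a} {zero}  a≢b =
  subst (_≤ sum f) (+-comm (f zero) _) (+-monoʳ-≤ (f zero) (term≤sum (f ∘ suc) a))
two-terms≤sum f {suc a} {suc b} a≢b =
  ≤-trans (two-terms≤sum (f ∘ suc) (a≢b ∘ cong suc)) (m≤n+m _ (f zero))

𝟙 : ∀ {p} {P : Set p} → Dec P → ℕ
𝟙 (yes _) = 1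
𝟙 (no _)  = 0

module _ {p} {P : Set p} where

  𝟙-yes : (P? : Dec P) → P → 𝟙 P? ≡ 1
  𝟙-yes (yes _) _  = refl
  𝟙-yes (no ¬p) p = ⊥-elim (¬p p)

  𝟙-no : (P? : Dec P) → ¬ P → 𝟙 P? ≡ 0
  𝟙-no (yes p) ¬p = ⊥-elim (¬p p)
  𝟙-no (no _)  _  = refl

𝟙-mono : ∀ {p q} {P : Set p} {Q : Set q} (P? : Dec P) (Q? : Dec Q) → (P → Q) → 𝟙 P? ≤ 𝟙 Q?
𝟙-mono (yes p) Q? P→Q = ≤-reflexive (sym (𝟙-yes Q? (P→Q p)))
𝟙-mono (no _)  Q? P→Q = z≤n

module _ {p q} {P : Set p} {Q : Set q} where

  𝟙-cong : (P? : Dec P) (Q? : Dec Q) → (P → Q) → (Q → P) → 𝟙 P? ≡ 𝟙 Q?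
  𝟙-cong P? Q? P→Q Q→P = ≤-antisym (𝟙-mono P? Q? P→Q) (𝟙-mono Q? P? Q→P)

  𝟙-× : (P? : Dec P) (Q? : Dec Q) → 𝟙 P? * 𝟙 Q? ≡ 𝟙 (P? ×-dec Q?)
  𝟙-× (yes _) (yes _) = refl
  𝟙-× (yes _) (no _)  = refl
  𝟙-× (no _)  _       = refl

count : ∀ {n p} {P : Fin n → Set p} → Decidable P → ℕ
count P? = sum (λ i → 𝟙 (P? i))

module _ {n p} {P : Fin n → Set p} (P? : Decidable P) where

  count-≥1 : ∀ {a} → P a → 1 ≤ count P?
  count-≥1 {a} pa = subst (_≤ count P?) (𝟙-yes (P? a) pa) (term≤sum _ a)

  count-≥2 : ∀ {a b} → a ≢ b → P a → P b → 2 ≤ count P?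
  count-≥2 {a} {b} a≢b pa pb =
    subst₂ (λ x y → x + y ≤ count P?) (𝟙-yes (P? a) pa) (𝟙-yes (P? b) pb) (two-terms≤sum _ a≢b)

count-≤1 : ∀ {n p} {P : Fin n → Set p} (P? : Decidable P) →
           (∀ {a b} → P a → P b → a ≡ b) → count P? ≤ 1
count-≤1 {zero}  P? unique = z≤n
count-≤1 {suc n} P? unique with P? zero
... | yes p₀ = ≤-reflexive (cong suc (ℕΣ.sum-zero _ λ i → 𝟙-no (P? (suc i)) (0≢1+n ∘ unique p₀)))
... | no _   = count-≤1 (P? ∘ suc) (λ pa pb → suc-injective (unique pa pb))

module _ {n p q} {P : Fin n → Set p} {Q : Fin n → Set q} (P? : Decidable P) (Q? : Decidable Q) where

  count-cong : (∀ {i} → P i → Q i) → (∀ {i} → Q i → P i) → count P? ≡ count Q?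
  count-cong P→Q Q→P = ℕΣ.sum-cong-≗ λ i → 𝟙-cong (P? i) (Q? i) P→Q Q→P

  count-mono-< : (∀ {i} → P i → Q i) → ∀ {a} → Q a → ¬ P a → count P? < count Q?
  count-mono-< P→Q {a} qa ¬pa = sum-mono-< (λ i → 𝟙-mono (P? i) (Q? i) P→Q) a
    (subst₂ _<_ (sym (𝟙-no (P? a) ¬pa)) (sym (𝟙-yes (Q? a) qa)) (s≤s z≤n))

module _ {A : Set} (R : A → A → Set) where

  Cycle : List A → Set
  Cycle []       = ⊥
  Cycle (x ∷ xs) = Unique (x ∷ xs) × Linked R (x ∷ xs ++ [ x ])

  Linked-∷ʳ : ∀ xs {x y} → Linked R (xs ∷ʳ x) → R x y → Linked R (xs ∷ʳ x ∷ʳ y)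
  Linked-∷ʳ []           _           Rxy = Rxy ∷ [-]
  Linked-∷ʳ (_ ∷ [])     (Rzx ∷ [-]) Rxy = Rzx ∷ Rxy ∷ [-]
  Linked-∷ʳ (_ ∷ w ∷ xs) (Rzw ∷ lk)  Rxy = Rzw ∷ Linked-∷ʳ (w ∷ xs) lk Rxy

  Linked-last : ∀ xs {x y} → Linked R (xs ∷ʳ x ∷ʳ y) → R x y
  Linked-last []       (Rxy ∷ [-]) = Rxy
  Linked-last (_ ∷ xs) lk          = Linked-last xs (Linked.tail lk)

  Unique-rotate : ∀ (x : A) xs → Unique (x ∷ xs) → Unique (xs ∷ʳ x)
  Unique-rotate x []       _                           = [] ∷ []
  Unique-rotate x (y ∷ xs) ((x≢y ∷ x∉xs) ∷ y∉xs ∷ uxs) =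
    All-++⁺ y∉xs ((x≢y ∘ sym) ∷ []) ∷ Unique-rotate x xs (x∉xs ∷ uxs)

  Cycle-rotate₁ : ∀ (x : A) xs → Cycle (x ∷ xs) → Cycle (xs ∷ʳ x)
  Cycle-rotate₁ x []       c                = c
  Cycle-rotate₁ x (y ∷ xs) (u , Rxy ∷ lk) =
    Unique-rotate x (y ∷ xs) u , Linked-∷ʳ (y ∷ xs) lk Rxy

  Cycle-rotate : ∀ xs (v : A) ys → Cycle (xs ++ v ∷ ys) → Cycle (v ∷ ys ++ xs)
  Cycle-rotate []       v ys c = subst Cycle (cong (v ∷_) (sym (++-identityʳ ys))) c
  Cycle-rotate (x ∷ xs) v ys c =
    subst Cycle (cong (v ∷_) (++-assoc ys [ x ] xs))
      (Cycle-rotate xs v (ys ∷ʳ x)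
        (subst Cycle (++-assoc xs (v ∷ ys) [ x ]) (Cycle-rotate₁ x (xs ++ v ∷ ys) c)))

length-rotate : ∀ {A : Set} (xs : List A) v ys → length (xs ++ v ∷ ys) ≡ length (v ∷ ys ++ xs)
length-rotate xs v ys = begin
  length (xs ++ v ∷ ys)          ≡⟨ length-++ xs ⟩
  length xs + suc (length ys)    ≡⟨ +-suc (length xs) (length ys) ⟩
  suc (length xs + length ys)    ≡⟨ cong suc (+-comm (length xs) (length ys)) ⟩
  suc (length ys + length xs)    ≡⟨ cong suc (sym (length-++ ys)) ⟩
  length (v ∷ ys ++ xs)          ∎
  where open ≡-Reasoning

-- The Hasse diagram is treated as an oriented graph so that each undirected edge is counted once;
-- Adj, Path, Connected and HasCycle below mirror those of Defs.Notions.
module OrientedGraph {n} (_⇾_ : Fin n → Fin n → Set) (_⇾?_ : ∀ x y → Dec (x ⇾ y))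
                     (⇾-irrefl : ∀ {x} → ¬ x ⇾ x) (⇾-asym : ∀ {x y} → x ⇾ y → ¬ y ⇾ x) where

  private variable
    C S T : Subset n
    a b c r u v w x y z : Fin n
    xs ws : List (Fin n)

  _—_ : Fin n → Fin n → Set
  x — y = x ⇾ y ⊎ y ⇾ x

  _—?_ : ∀ x y → Dec (x — y)
  x —? y = (x ⇾? y) ⊎-dec (y ⇾? x)

  —-sym : x — y → y — x
  —-sym (inj₁ x⇾y) = inj₂ x⇾y
  —-sym (inj₂ y⇾x) = inj₁ y⇾x

  Adj : Subset n → Fin n → Fin n → Set
  Adj S x y = x ∈ S × y ∈ S × x — y

  data Path (S : Subset n) : Fin n → Fin n → Set where
    here : ∀ {x} → x ∈ S → Path S x x
    step : ∀ {x y z} → Adj S x y → Path S y z → Path S x z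

  Connected : Subset n → Set
  Connected S = ∀ x y → x ∈ S → y ∈ S → Path S x y

  HasCycle : Subset n → Set
  HasCycle S = Σ (Fin n) λ v → Σ (List (Fin n)) λ vs →
               3 ≤ length (v ∷ vs) × Cycle (Adj S) (v ∷ vs)

  𝟙[_∈_] : Fin n → Subset n → ℕ
  𝟙[ x ∈ S ] = 𝟙 (x ∈? S)

  vertexCount : Subset n → ℕ
  vertexCount S = sum λ x → 𝟙[ x ∈ S ]

  inDegree outDegree degree : Subset n → Fin n → ℕ
  inDegree  S x = sum λ m → 𝟙[ m ∈ S ] * 𝟙 (m ⇾? x)
  outDegree S x = sum λ m → 𝟙[ m ∈ S ] * 𝟙 (x ⇾? m)
  degree    S x = inDegree S x + outDegree S x

  edgeCount : Subset n → ℕ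
  edgeCount S = sum λ x → 𝟙[ x ∈ S ] * inDegree S x

  module _ {S : Subset n} {v : Fin n} (v∉S : v ∉ S) where

    𝟙-∈-insert : ∀ x → 𝟙[ x ∈ S ∪ ⁅ v ⁆ ] ≡ 𝟙[ x ∈ S ] + 𝟙 (x ≟ v)
    𝟙-∈-insert x with x ∈? S ∪ ⁅ v ⁆ | x ∈? S | x ≟ v
    ... | _     | yes x∈S | yes refl = ⊥-elim (v∉S x∈S)
    ... | yes _ | yes _   | no _     = refl
    ... | yes _ | no _    | yes _    = refl
    ... | yes x∈S∪v | no x∉S | no x≢v with x∈p∪q⁻ S ⁅ v ⁆ x∈S∪v
    ...   | inj₁ x∈S = ⊥-elim (x∉S x∈S)
    ...   | inj₂ x∈v = ⊥-elim (x≢v (x∈⁅y⁆⇒x≡y v x∈v))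
    𝟙-∈-insert x | no x∉S∪v | yes x∈S | _ = ⊥-elim (x∉S∪v (x∈p∪q⁺ (inj₁ x∈S)))
    𝟙-∈-insert x | no x∉S∪v | no _ | yes refl = ⊥-elim (x∉S∪v (x∈p∪q⁺ (inj₂ (x∈⁅x⁆ x))))
    𝟙-∈-insert x | no _ | no _ | no _ = refl

    sum-insert : (g : Fin n → ℕ) →
                 sum (λ x → 𝟙[ x ∈ S ∪ ⁅ v ⁆ ] * g x) ≡ sum (λ x → 𝟙[ x ∈ S ] * g x) + g v
    sum-insert g = begin
      sum (λ x → 𝟙[ x ∈ S ∪ ⁅ v ⁆ ] * g x)
        ≡⟨ ℕΣ.sum-cong-≗ {n} (λ x → trans (cong (_* g x) (𝟙-∈-insert x))
                                          (*-distribʳ-+ (g x) 𝟙[ x ∈ S ] (𝟙 (x ≟ v)))) ⟩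
      sum (λ x → 𝟙[ x ∈ S ] * g x + 𝟙 (x ≟ v) * g x)
        ≡⟨ ℕΣ.∑-distrib-+ (λ x → 𝟙[ x ∈ S ] * g x) (λ x → 𝟙 (x ≟ v) * g x) ⟩
      sum (λ x → 𝟙[ x ∈ S ] * g x) + sum (λ x → 𝟙 (x ≟ v) * g x)
        ≡⟨ cong (_+_ (sum (λ x → 𝟙[ x ∈ S ] * g x)))
                (ℕΣ.sum-single _ v λ x x≢v → cong (_* g x) (𝟙-no (x ≟ v) x≢v)) ⟩
      sum (λ x → 𝟙[ x ∈ S ] * g x) + 𝟙 (v ≟ v) * g v
        ≡⟨ cong (λ k → sum (λ x → 𝟙[ x ∈ S ] * g x) + k * g v) (𝟙-yes (v ≟ v) refl) ⟩
      sum (λ x → 𝟙[ x ∈ S ] * g x) + 1 * g v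
        ≡⟨ cong (_+_ (sum (λ x → 𝟙[ x ∈ S ] * g x))) (*-identityˡ (g v)) ⟩
      sum (λ x → 𝟙[ x ∈ S ] * g x) + g v ∎
      where open ≡-Reasoning

    vertexCount-insert : vertexCount (S ∪ ⁅ v ⁆) ≡ vertexCount S + 1
    vertexCount-insert = begin
      vertexCount (S ∪ ⁅ v ⁆)            ≡⟨ ℕΣ.sum-cong-≗ {n} (sym ∘ *-identityʳ ∘ 𝟙[_∈ S ∪ ⁅ v ⁆ ]) ⟩
      sum (λ x → 𝟙[ x ∈ S ∪ ⁅ v ⁆ ] * 1) ≡⟨ sum-insert (λ _ → 1) ⟩
      sum (λ x → 𝟙[ x ∈ S ] * 1) + 1     ≡⟨ cong (_+ 1) (ℕΣ.sum-cong-≗ {n} (*-identityʳ ∘ 𝟙[_∈ S ])) ⟩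
      vertexCount S + 1                  ∎
      where open ≡-Reasoning

    edgeCount-insert : edgeCount (S ∪ ⁅ v ⁆) ≡ edgeCount S + degree S v
    edgeCount-insert = begin
      edgeCount (S ∪ ⁅ v ⁆)
        ≡⟨ ℕΣ.sum-cong-≗ {n} (λ x → cong (𝟙[ x ∈ S ∪ ⁅ v ⁆ ] *_) (sum-insert (λ m → 𝟙 (m ⇾? x)))) ⟩
      sum (λ x → 𝟙[ x ∈ S ∪ ⁅ v ⁆ ] * (inDegree S x + 𝟙 (v ⇾? x)))
        ≡⟨ ℕΣ.sum-cong-≗ {n} (λ x → *-distribˡ-+ 𝟙[ x ∈ S ∪ ⁅ v ⁆ ] (inDegree S x) _) ⟩
      sum (λ x → 𝟙[ x ∈ S ∪ ⁅ v ⁆ ] * inDegree S x + 𝟙[ x ∈ S ∪ ⁅ v ⁆ ] * 𝟙 (v ⇾? x))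
        ≡⟨ ℕΣ.∑-distrib-+ (λ x → 𝟙[ x ∈ S ∪ ⁅ v ⁆ ] * inDegree S x) (λ x → 𝟙[ x ∈ S ∪ ⁅ v ⁆ ] * 𝟙 (v ⇾? x)) ⟩
      sum (λ x → 𝟙[ x ∈ S ∪ ⁅ v ⁆ ] * inDegree S x) + sum (λ x → 𝟙[ x ∈ S ∪ ⁅ v ⁆ ] * 𝟙 (v ⇾? x))
        ≡⟨ cong₂ _+_ (sum-insert (inDegree S)) (sum-insert (λ x → 𝟙 (v ⇾? x))) ⟩
      (edgeCount S + inDegree S v) + (outDegree S v + 𝟙 (v ⇾? v))
        ≡⟨ cong (λ k → edgeCount S + inDegree S v + (outDegree S v + k)) (𝟙-no (v ⇾? v) ⇾-irrefl) ⟩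
      (edgeCount S + inDegree S v) + (outDegree S v + 0)
        ≡⟨ cong (_+_ (edgeCount S + inDegree S v)) (+-identityʳ _) ⟩
      (edgeCount S + inDegree S v) + outDegree S v
        ≡⟨ +-assoc (edgeCount S) _ _ ⟩
      edgeCount S + degree S v ∎
      where open ≡-Reasoning

  module _ (S : Subset n) (v : Fin n) where

    neighbour? : Decidable λ u → u ∈ S × u — v
    neighbour? u = (u ∈? S) ×-dec (u —? v)

    degree≡count-neighbours : degree S v ≡ count neighbour?
    degree≡count-neighbours = begin
      inDegree S v + outDegree S v
        ≡⟨ ℕΣ.∑-distrib-+ (λ u → 𝟙[ u ∈ S ] * 𝟙 (u ⇾? v)) (λ u → 𝟙[ u ∈ S ] * 𝟙 (v ⇾? u)) ⟨
      sum (λ u → 𝟙[ u ∈ S ] * 𝟙 (u ⇾? v) + 𝟙[ u ∈ S ] * 𝟙 (v ⇾? u))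
        ≡⟨ ℕΣ.sum-cong-≗ split ⟩
      count neighbour? ∎
      where
      open ≡-Reasoning
      split : ∀ u → 𝟙[ u ∈ S ] * 𝟙 (u ⇾? v) + 𝟙[ u ∈ S ] * 𝟙 (v ⇾? u) ≡ 𝟙 (neighbour? u)
      split u with u ∈? S | u ⇾? v | v ⇾? u
      ... | no _  | _       | _       = refl
      ... | yes _ | yes u⇾v | yes v⇾u = ⊥-elim (⇾-asym u⇾v v⇾u)
      ... | yes _ | yes _   | no _    = refl
      ... | yes _ | no _    | yes _   = refl
      ... | yes _ | no _    | no _    = refl

  degree-≥1 : u ∈ S → u — v → 1 ≤ degree S v
  degree-≥1 {S = S} {v = v} u∈S u—v =
    subst (1 ≤_) (sym (degree≡count-neighbours S v)) (count-≥1 (neighbour? S v) (u∈S , u—v))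

  degree-≥2 : a ≢ b → a ∈ S → a — v → b ∈ S → b — v → 2 ≤ degree S v
  degree-≥2 {S = S} {v = v} a≢b a∈S a—v b∈S b—v =
    subst (2 ≤_) (sym (degree≡count-neighbours S v))
      (count-≥2 (neighbour? S v) a≢b (a∈S , a—v) (b∈S , b—v))

  degree-≤1 : (∀ {a b} → a ∈ S × a — v → b ∈ S × b — v → a ≡ b) → degree S v ≤ 1
  degree-≤1 {S = S} {v = v} unique =
    subst (_≤ 1) (sym (degree≡count-neighbours S v)) (count-≤1 (neighbour? S v) unique)

  Adj-mono : S ⊆ T → ∀ {x y} → Adj S x y → Adj T x y
  Adj-mono S⊆T (x∈S , y∈S , x—y) = S⊆T x∈S , S⊆T y∈S , x—y

  Path-mono : S ⊆ T → ∀ {x y} → Path S x y → Path T x y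
  Path-mono S⊆T (here x∈S)  = here (S⊆T x∈S)
  Path-mono S⊆T (step xy p) = step (Adj-mono S⊆T xy) (Path-mono S⊆T p)

  Path-∷ʳ : Path S x y → Adj S y z → Path S x z
  Path-∷ʳ (here _)    yz = step yz (here (proj₁ (proj₂ yz)))
  Path-∷ʳ (step xw p) yz = step xw (Path-∷ʳ p yz)

  Path-source : Path S x y → x ∈ S
  Path-source (here x∈S)             = x∈S
  Path-source (step (x∈S , _ , _) _) = x∈S

  Path-target : Path S x y → y ∈ S
  Path-target (here y∈S) = y∈S
  Path-target (step _ p) = Path-target p

  Path-exit : Path T x y → x ∈ S → y ∉ S → ∃ λ a → ∃ λ v → a ∈ S × v ∉ S × Adj T a v
  Path-exit (here _) x∈S x∉S = ⊥-elim (x∉S x∈S)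
  Path-exit {S = S} (step {y = w} xw p) x∈S y∉S with w ∈? S
  ... | yes w∈S = Path-exit p w∈S y∉S
  ... | no  w∉S = _ , _ , x∈S , w∉S , xw

  vertices : Path S x y → List (Fin n)
  vertices (here {x} _)   = [ x ]
  vertices (step {x} _ p) = x ∷ vertices p

  vertices-⊆ : (p : Path S x y) → All (_∈ S) (vertices p)
  vertices-⊆ (here x∈S)             = x∈S ∷ []
  vertices-⊆ (step (x∈S , _ , _) p) = x∈S ∷ vertices-⊆ p

  vertices-length : (p : Path S x y) → x ≢ y → 2 ≤ length (vertices p)
  vertices-length (here _)            x≢x = ⊥-elim (x≢x refl)
  vertices-length (step _ (here _))   _   = s≤s (s≤s z≤n)
  vertices-length (step _ (step _ _)) _   = s≤s (s≤s z≤n)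

  Path-suffix : (p : Path S y z) → x ∈ₗ vertices p →
                Σ (Path S x z) λ q → Unique (vertices p) → Unique (vertices q)
  Path-suffix p@(here _)   (here refl) = p , λ u → u
  Path-suffix p@(step _ _) (here refl) = p , λ u → u
  Path-suffix (step _ p)   (there x∈p) with Path-suffix p x∈p
  ... | q , uq = q , λ { (_ ∷ u) → uq u }

  Path-shorten : Path S x y → Σ (Path S x y) (Unique ∘ vertices)
  Path-shorten (here x∈S) = here x∈S , [] ∷ []
  Path-shorten {x = x} (step xy p) with Path-shorten p
  ... | q , uq with anyₗ? (x ≟_) (vertices q)
  ...   | yes x∈q = let (q′ , uq′) = Path-suffix q x∈q in q′ , uq′ uq
  ...   | no  x∉q = step xy q , ¬Any⇒All¬ (vertices q) x∉q ∷ uq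

  Linked-vertices : S ⊆ T → Adj T w x → (p : Path S x z) → Adj T z u →
                    Linked (Adj T) (w ∷ vertices p ∷ʳ u)
  Linked-vertices S⊆T wx (here _)    zu = wx ∷ zu ∷ [-]
  Linked-vertices S⊆T wx (step xy p) zu = wx ∷ Linked-vertices S⊆T (Adj-mono S⊆T xy) p zu

  HasCycle-mono : S ⊆ T → HasCycle S → HasCycle T
  HasCycle-mono S⊆T (v , vs , len , u , lk) = v , vs , len , u , Linked.map (Adj-mono S⊆T) lk

  HasCycle-close : v ∉ S → S ⊆ T → v ∈ T → (p : Path S b c) → Unique (vertices p) →
                   b ≢ c → b — v → c — v → HasCycle T
  HasCycle-close {S = S} v∉S S⊆T v∈T p up b≢c b—v c—v =
    _ , vertices p , s≤s (vertices-length p b≢c) ,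
    All.map (λ x∈S v≡x → v∉S (subst (_∈ S) (sym v≡x) x∈S)) (vertices-⊆ p) ∷ up ,
    Linked-vertices S⊆T (v∈T , S⊆T (Path-source p) , —-sym b—v) p
                        (S⊆T (Path-target p) , v∈T , c—v)

  ⊆-insert : ∀ v → S ⊆ S ∪ ⁅ v ⁆
  ⊆-insert v = p⊆p∪q ⁅ v ⁆

  ∈-insert : ∀ S {v : Fin n} → v ∈ S ∪ ⁅ v ⁆
  ∈-insert S {v = v} = x∈p∪q⁺ (inj₂ (x∈⁅x⁆ v))

  ∈-insert⁻ : x ∈ S ∪ ⁅ v ⁆ → v ≢ x → x ∈ S
  ∈-insert⁻ {S = S} {v = v} x∈S∪v v≢x with x∈p∪q⁻ S ⁅ v ⁆ x∈S∪v
  ... | inj₁ x∈S = x∈S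
  ... | inj₂ x∈v = ⊥-elim (v≢x (sym (x∈⁅y⁆⇒x≡y v x∈v)))

  Linked-restrict : Linked (Adj (S ∪ ⁅ v ⁆)) xs → All (v ≢_) xs → Linked (Adj S) xs
  Linked-restrict []                     _                     = []
  Linked-restrict [-]                    _                     = [-]
  Linked-restrict ((x∈ , y∈ , x—y) ∷ lk) (v≢x ∷ v≢y ∷ v≢xs) =
    (∈-insert⁻ x∈ v≢x , ∈-insert⁻ y∈ v≢y , x—y) ∷ Linked-restrict lk (v≢y ∷ v≢xs)

  Cycle-degree : Cycle (Adj (S ∪ ⁅ v ⁆)) (v ∷ ws) → 3 ≤ length (v ∷ ws) → 2 ≤ degree S v
  Cycle-degree {ws = ws} c len with initLast ws
  Cycle-degree _ (s≤s ()) | []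
  Cycle-degree _ (s≤s (s≤s ())) | [] ∷ʳ′ _
  Cycle-degree {S = S} {v = v} ((v≢w₁ ∷ v∉rest) ∷ (w₁∉rest ∷ _) , lk) _ | (w₁ ∷ mid) ∷ʳ′ wₖ =
    degree-≥2 (All.lookup w₁∉rest wₖ∈rest)
      (∈-insert⁻ (proj₁ (proj₂ v-w₁)) v≢w₁) (—-sym (proj₂ (proj₂ v-w₁)))
      (∈-insert⁻ (proj₁ wₖ-v) (All.lookup v∉rest wₖ∈rest)) (proj₂ (proj₂ wₖ-v))
    where
    wₖ∈rest : wₖ ∈ₗ mid ∷ʳ wₖ
    wₖ∈rest = ∈-++⁺ʳ mid (here refl)
    v-w₁ : Adj (S ∪ ⁅ v ⁆) v w₁
    v-w₁ = Linked.head lk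
    wₖ-v : Adj (S ∪ ⁅ v ⁆) wₖ v
    wₖ-v = Linked-last _ (v ∷ w₁ ∷ mid) lk

  HasCycle-insert : HasCycle (S ∪ ⁅ v ⁆) → HasCycle S ⊎ 2 ≤ degree S v
  HasCycle-insert {S = S} {v = v} (v₀ , vs , len , c) with anyₗ? (v ≟_) (v₀ ∷ vs)
  ... | no v∉c = inj₁ (v₀ , vs , len , proj₁ c ,
                       Linked-restrict (proj₂ c) (All-++⁺ v≢c (All.head v≢c ∷ [])))
    where v≢c = ¬Any⇒All¬ (v₀ ∷ vs) v∉c
  ... | yes v∈c with ∈-∃++ v∈c
  ...   | ys , zs , c≡ys++v∷zs = inj₂ (Cycle-degree
            (Cycle-rotate _ ys v zs (subst (Cycle _) c≡ys++v∷zs c))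
            (subst (3 ≤_) (trans (cong length c≡ys++v∷zs) (length-rotate ys v zs)) len))

  Connected-insert : Connected S → a ∈ S → a — v → Connected (S ∪ ⁅ v ⁆)
  Connected-insert {S = S} {a = a} {v = v} conn a∈S a—v x y x∈ y∈
    with x∈p∪q⁻ S ⁅ v ⁆ x∈ | x∈p∪q⁻ S ⁅ v ⁆ y∈
  ... | inj₁ x∈S | inj₁ y∈S = Path-mono (⊆-insert v) (conn x y x∈S y∈S)
  ... | inj₁ x∈S | inj₂ y∈v rewrite x∈⁅y⁆⇒x≡y v y∈v =
    Path-∷ʳ (Path-mono (⊆-insert v) (conn x a x∈S a∈S)) (⊆-insert v a∈S , ∈-insert S , a—v)
  ... | inj₂ x∈v | inj₁ y∈S rewrite x∈⁅y⁆⇒x≡y v x∈v =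
    step (∈-insert S , ⊆-insert v a∈S , —-sym a—v) (Path-mono (⊆-insert v) (conn a y a∈S y∈S))
  ... | inj₂ x∈v | inj₂ y∈v rewrite x∈⁅y⁆⇒x≡y v x∈v | x∈⁅y⁆⇒x≡y v y∈v =
    here (∈-insert S)

  acyclic-insert⇒degree≤1 : Connected S → v ∉ S → ¬ HasCycle (S ∪ ⁅ v ⁆) → degree S v ≤ 1
  acyclic-insert⇒degree≤1 {S = S} {v = v} conn v∉S acyclic = degree-≤1 same
    where
    same : ∀ {b c} → b ∈ S × b — v → c ∈ S × c — v → b ≡ c
    same {b} {c} (b∈S , b—v) (c∈S , c—v) with b ≟ c
    ... | yes b≡c = b≡c
    ... | no  b≢c with Path-shorten (conn b c b∈S c∈S)
    ...   | p , up =
      ⊥-elim (acyclic (HasCycle-close v∉S (⊆-insert v) (∈-insert S) p up b≢c b—v c—v))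

  record CyclomaticBounds (S : Subset n) : Set where
    field
      connected                : Connected S
      vertices≤edges+1         : vertexCount S ≤ edgeCount S + 1
      cyclic⇒vertices≤edges    : HasCycle S → vertexCount S ≤ edgeCount S
      acyclic⇒edges+1≤vertices : ¬ HasCycle S → edgeCount S + 1 ≤ vertexCount S

  CyclomaticBounds-insert : CyclomaticBounds S → v ∉ S → a ∈ S → a — v →
                            CyclomaticBounds (S ∪ ⁅ v ⁆)
  CyclomaticBounds-insert {S = S} {v = v} {a = a} bounds v∉S a∈S a—v = record
    { connected                = Connected-insert connected a∈S a—v
    ; vertices≤edges+1         = counts {λ V E → V ≤ E + 1}
        (+-monoˡ-≤ 1 (≤-trans vertices≤edges+1 (+-monoʳ-≤ (edgeCount S) degree≥1)))
    ; cyclic⇒vertices≤edges    = λ cyclic →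
        counts {λ V E → V ≤ E} (cyclic-bound (HasCycle-insert cyclic))
    ; acyclic⇒edges+1≤vertices = λ acyclic → counts {λ V E → E + 1 ≤ V}
        (+-monoˡ-≤ 1 (≤-trans
          (+-monoʳ-≤ (edgeCount S) (acyclic-insert⇒degree≤1 connected v∉S acyclic))
          (acyclic⇒edges+1≤vertices (acyclic ∘ HasCycle-mono (⊆-insert v)))))
    }
    where
    open CyclomaticBounds bounds
    counts : ∀ {P : ℕ → ℕ → Set} → P (vertexCount S + 1) (edgeCount S + degree S v) →
             P (vertexCount (S ∪ ⁅ v ⁆)) (edgeCount (S ∪ ⁅ v ⁆))
    counts {P} = subst₂ P (sym (vertexCount-insert v∉S)) (sym (edgeCount-insert v∉S))
    degree≥1 : 1 ≤ degree S v
    degree≥1 = degree-≥1 a∈S a—v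
    cyclic-bound : HasCycle S ⊎ 2 ≤ degree S v → vertexCount S + 1 ≤ edgeCount S + degree S v
    cyclic-bound (inj₁ cyclic)   = +-mono-≤ (cyclic⇒vertices≤edges cyclic) degree≥1
    cyclic-bound (inj₂ degree≥2) = begin
      vertexCount S + 1     ≤⟨ +-monoˡ-≤ 1 vertices≤edges+1 ⟩
      edgeCount S + 1 + 1   ≡⟨ +-assoc (edgeCount S) 1 1 ⟩
      edgeCount S + 2       ≤⟨ +-monoʳ-≤ (edgeCount S) degree≥2 ⟩
      edgeCount S + degree S v ∎
      where open ≤-Reasoning

  ∈-singleton : x ∈ ∅ ∪ ⁅ r ⁆ → x ≡ r
  ∈-singleton {r = r} x∈ with x∈p∪q⁻ ∅ ⁅ r ⁆ x∈
  ... | inj₁ x∈∅ = ⊥-elim (∉⊥ x∈∅)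
  ... | inj₂ x∈r = x∈⁅y⁆⇒x≡y r x∈r

  sum-∅ : (g : Fin n → ℕ) → sum (λ x → 𝟙[ x ∈ ∅ ] * g x) ≡ 0
  sum-∅ g = ℕΣ.sum-zero (λ x → 𝟙[ x ∈ ∅ ] * g x) (λ x → cong (_* g x) (𝟙-no (x ∈? ∅) ∉⊥))

  -- Stated for ∅ ∪ ⁅ r ⁆ rather than ⁅ r ⁆ so that the insertion lemmas apply.
  CyclomaticBounds-singleton : ∀ r → CyclomaticBounds (∅ ∪ ⁅ r ⁆)
  CyclomaticBounds-singleton r = record
    { connected                = λ x y x∈ y∈ →
        subst₂ (Path (∅ ∪ ⁅ r ⁆)) (sym (∈-singleton x∈)) (sym (∈-singleton y∈))
          (here (∈-insert ∅))
    ; vertices≤edges+1         = ≤-reflexive (trans vertices≡1 (cong (_+ 1) (sym edges≡0)))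
    ; cyclic⇒vertices≤edges    = ⊥-elim ∘ acyclic
    ; acyclic⇒edges+1≤vertices = λ _ → ≤-reflexive (trans (cong (_+ 1) edges≡0) (sym vertices≡1))
    }
    where
    vertices≡1 : vertexCount (∅ ∪ ⁅ r ⁆) ≡ 1
    vertices≡1 = trans (vertexCount-insert ∉⊥)
                   (cong (_+ 1) (ℕΣ.sum-zero 𝟙[_∈ ∅ ] (λ x → 𝟙-no (x ∈? ∅) ∉⊥)))
    edges≡0 : edgeCount (∅ ∪ ⁅ r ⁆) ≡ 0
    edges≡0 = trans (edgeCount-insert ∉⊥)
                (cong₂ _+_ (sum-∅ (inDegree ∅))
                           (cong₂ _+_ (sum-∅ λ m → 𝟙 (m ⇾? r)) (sum-∅ λ m → 𝟙 (r ⇾? m))))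
    acyclic : ¬ HasCycle (∅ ∪ ⁅ r ⁆)
    acyclic (_ , [] , s≤s () , _)
    acyclic (_ , _ ∷ _ , _ , (v₀≢w ∷ _) ∷ _ , (v₀∈ , w∈ , _) ∷ _) =
      v₀≢w (trans (∈-singleton v₀∈) (sym (∈-singleton w∈)))

  CyclomaticBounds-grow : Connected C → ∀ k → S ⊆ C → ∣ C ∣ ≤ ∣ S ∣ + k → r ∈ S →
                          CyclomaticBounds S → CyclomaticBounds C
  CyclomaticBounds-grow {C = C} {S = S} conn k S⊆C size r∈S bounds
    with any? (λ x → x ∈? C ×-dec ¬? (x ∈? S))
  ... | no C⊆S = subst CyclomaticBounds (⊆-antisym S⊆C C⊆S′) bounds
    where
    C⊆S′ : C ⊆ S
    C⊆S′ {x} x∈C with x ∈? S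
    ... | yes x∈S = x∈S
    ... | no  x∉S = ⊥-elim (C⊆S (x , x∈C , x∉S))
  ... | yes (c , c∈C , c∉S) with Path-exit (conn _ c (S⊆C r∈S) c∈C) r∈S c∉S
  ...   | a , v , a∈S , v∉S , (_ , v∈C , a—v) with k
  ...     | zero =
    ⊥-elim (<⇒≱ (p⊂q⇒∣p∣<∣q∣ (S⊆C , c , c∈C , c∉S)) (subst (∣ C ∣ ≤_) (+-identityʳ _) size))
  ...     | suc k′ = CyclomaticBounds-grow conn k′ S′⊆C size′ (⊆-insert v r∈S)
                       (CyclomaticBounds-insert bounds v∉S a∈S a—v)
    where
    S′⊆C : S ∪ ⁅ v ⁆ ⊆ C
    S′⊆C {x} x∈S′ with x∈p∪q⁻ S ⁅ v ⁆ x∈S′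
    ... | inj₁ x∈S = S⊆C x∈S
    ... | inj₂ x∈v rewrite x∈⁅y⁆⇒x≡y v x∈v = v∈C
    size′ : ∣ C ∣ ≤ ∣ S ∪ ⁅ v ⁆ ∣ + k′
    size′ = begin
      ∣ C ∣                    ≤⟨ size ⟩
      ∣ S ∣ + suc k′           ≡⟨ +-suc ∣ S ∣ k′ ⟩
      suc ∣ S ∣ + k′
        ≤⟨ +-monoˡ-≤ k′ (p⊂q⇒∣p∣<∣q∣ (⊆-insert v , v , ∈-insert S , v∉S)) ⟩
      ∣ S ∪ ⁅ v ⁆ ∣ + k′       ∎
      where open ≤-Reasoning

  Connected⇒CyclomaticBounds : Connected C → r ∈ C → CyclomaticBounds C
  Connected⇒CyclomaticBounds {C = C} {r = r} conn r∈C =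
    CyclomaticBounds-grow conn n (λ x∈ → subst (_∈ C) (sym (∈-singleton x∈)) r∈C)
      (≤-trans (∣p∣≤n C) (m≤n+m n _)) (∈-insert ∅) (CyclomaticBounds-singleton r)

  edges+1≡vertices⇔acyclic : Connected C → r ∈ C →
                             edgeCount C + 1 ≡ vertexCount C ⇔ (¬ HasCycle C)
  edges+1≡vertices⇔acyclic {C = C} conn r∈C = mk⇔
    (λ E+1≡V cyclic →
      m+1+n≰m (edgeCount C) (subst (_≤ edgeCount C) (sym E+1≡V) (cyclic⇒vertices≤edges cyclic)))
    (λ acyclic → ≤-antisym (acyclic⇒edges+1≤vertices acyclic) vertices≤edges+1)
    where
    open CyclomaticBounds (Connected⇒CyclomaticBounds conn r∈C)

-- Imported only here: ℤ's prefix +_ makes ℕ expressions above such as (m +_) ambiguous.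
open import Data.Integer using (ℤ; +_; -[1+_]; 0ℤ; 1ℤ) renaming (_+_ to _+ℤ_; -_ to -ℤ_)
import Data.Integer.Properties as ℤP
open import Data.Integer.Tactic.RingSolver using (solve-∀)

module ℤΣ = FinSum ℤP.+-0-commutativeMonoid

sumFin≡sum : ∀ {m} (f : Fin m → ℤ) → sumFin f ≡ ℤΣ.sum f
sumFin≡sum {zero}  f = refl
sumFin≡sum {suc m} f = cong (f zero +ℤ_) (sumFin≡sum (f ∘ suc))

sum-pos : ∀ {m} (f : Fin m → ℕ) → ℤΣ.sum (λ i → + f i) ≡ + sum f
sum-pos {zero}  f = refl
sum-pos {suc m} f = trans (cong (+ f zero +ℤ_) (sum-pos (f ∘ suc))) (sym (ℤP.pos-+ (f zero) _))

≡-1⇔+1≡ : ∀ s e v → s +ℤ + v ≡ + e → (s ≡ -[1+ 0 ] ⇔ e + 1 ≡ v)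
≡-1⇔+1≡ s e v s+v≡e = mk⇔
  (λ { refl → ℤP.+-injective (begin
    + (e + 1)                     ≡⟨ ℤP.pos-+ e 1 ⟩
    + e +ℤ 1ℤ                     ≡⟨ cong (_+ℤ 1ℤ) (sym s+v≡e) ⟩
    -[1+ 0 ] +ℤ + v +ℤ 1ℤ         ≡⟨ cancel-1 (+ v) ⟩
    + v                           ∎) })
  (λ { refl → begin
    s                             ≡⟨ add-sub s (+ v) ⟩
    s +ℤ + v +ℤ -ℤ + v            ≡⟨ cong (λ t → t +ℤ -ℤ + v) s+v≡e ⟩
    + e +ℤ -ℤ + (e + 1)           ≡⟨ cong (λ t → + e +ℤ -ℤ t) (ℤP.pos-+ e 1) ⟩
    + e +ℤ -ℤ (+ e +ℤ 1ℤ)         ≡⟨ sub-suc (+ e) ⟩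
    -[1+ 0 ]                      ∎ })
  where
  open ≡-Reasoning
  cancel-1 : ∀ a → -[1+ 0 ] +ℤ a +ℤ 1ℤ ≡ a
  cancel-1 = solve-∀
  add-sub : ∀ a b → a ≡ a +ℤ b +ℤ -ℤ b
  add-sub = solve-∀
  sub-suc : ∀ a → a +ℤ -ℤ (a +ℤ 1ℤ) ≡ -[1+ 0 ]
  sub-suc = solve-∀

module FinPosetFacts (P : FinPoset) where
  open Notions P
  open IsDecPartialOrder isDPO
    using (_≤?_) renaming (refl to ≼-refl; trans to ≼-trans; antisym to ≼-antisym)

  private variable
    x y z : Fin n

  _≺?_ : ∀ x y → Dec (x ≺ y)
  x ≺? y = (x ≤? y) ×-dec ¬? (x ≟ y)

  _⋖?_ : ∀ x y → Dec (x ⋖ y)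
  x ⋖? y = (x ≺? y) ×-dec all? (λ z → ¬? ((x ≺? z) ×-dec (z ≺? y)))

  ≺-trans : x ≺ y → y ≺ z → x ≺ z
  ≺-trans (x≼y , x≢y) (y≼z , _) = ≼-trans x≼y y≼z , λ { refl → x≢y (≼-antisym x≼y y≼z) }

  ⋖-irrefl : ¬ x ⋖ x
  ⋖-irrefl ((_ , x≢x) , _) = x≢x refl

  ⋖-asym : x ⋖ y → ¬ y ⋖ x
  ⋖-asym ((x≼y , x≢y) , _) ((y≼x , _) , _) = x≢y (≼-antisym x≼y y≼x)

  count-above-< : x ≺ z → count (z ≺?_) < count (x ≺?_)
  count-above-< x≺z = count-mono-< (_ ≺?_) (_ ≺?_) (≺-trans x≺z) x≺z λ z≺z → proj₂ z≺z refl

  ≺⇒≼-covered : x ≺ y → ∃ λ z → x ≼ z × z ⋖ y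
  ≺⇒≼-covered = go _ ≤-refl
    where
    go : ∀ k → count (x ≺?_) < k → x ≺ y → ∃ λ z → x ≼ z × z ⋖ y
    go {x} {y} (suc k) measure x≺y with any? (λ z → (x ≺? z) ×-dec (z ≺? y))
    ... | no nothing-between = x , ≼-refl , x≺y , λ z between → nothing-between (z , between)
    ... | yes (z , x≺z , z≺y) with go k (<-≤-trans (count-above-< x≺z) (s≤s⁻¹ measure)) z≺y
    ...   | w , z≼w , w⋖y = w , ≼-trans (proj₁ x≺z) z≼w , w⋖y

  InM⇒below-minimal : InM x → y ≺ x → Minimal y
  InM⇒below-minimal inM y≺x with ≺⇒≼-covered y≺x
  ... | z , y≼z , z⋖x = subst Minimal (sym (z-minimal _ y≼z)) z-minimal
    where
    z-minimal : Minimal z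
    z-minimal = inM z z⋖x

  Minimal⇒InM : Minimal y → InM y
  Minimal⇒InM y-minimal x ((x≼y , x≢y) , _) = ⊥-elim (x≢y (y-minimal x x≼y))

  downset-below : ∀ {C} → IsDownsetOfM C → x ∈ C → y ≺ x → y ∈ C × y ⋖ x
  downset-below {x} {y} (⊆M , closed) x∈C y≺x =
    closed x y x∈C (Minimal⇒InM y-minimal) (proj₁ y≺x) ,
    y≺x , λ z (y≺z , z≺x) → proj₂ y≺z (InM⇒below-minimal x-InM z≺x y (proj₁ y≺z))
    where
    x-InM : InM x
    x-InM = ⊆M x x∈C
    y-minimal : Minimal y
    y-minimal = InM⇒below-minimal x-InM y≺x

  module Hasse = OrientedGraph _⋖_ _⋖?_ ⋖-irrefl ⋖-asym

  Path⇒Hasse-Path : ∀ {C} → Path C x y → Hasse.Path C x y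
  Path⇒Hasse-Path (here x∈C)  = Hasse.here x∈C
  Path⇒Hasse-Path (step xy p) = Hasse.step xy (Path⇒Hasse-Path p)

  Connected⇒Hasse-Connected : ∀ {C} → Connected C → Hasse.Connected C
  Connected⇒Hasse-Connected connected x y x∈C y∈C = Path⇒Hasse-Path (connected x y x∈C y∈C)

  inDegree≡count-below : ∀ {C} → IsDownsetOfM C → x ∈ C → Hasse.inDegree C x ≡ count (_≺? x)
  inDegree≡count-below {x} {C} downset x∈C = begin
    sum (λ m → 𝟙 (m ∈? C) * 𝟙 (m ⋖? x))
      ≡⟨ ℕΣ.sum-cong-≗ {n} (λ m → 𝟙-× (m ∈? C) (m ⋖? x)) ⟩
    count (λ m → m ∈? C ×-dec m ⋖? x)
      ≡⟨ count-cong _ (_≺? x) (proj₁ ∘ proj₂) (downset-below downset x∈C) ⟩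
    count (_≺? x) ∎
    where open ≡-Reasoning

  module Möbius (μ : P̂ → ℤ) (isMöbius : IsMobius μ) where

    μ-0̂ : μ nothing ≡ 1ℤ
    μ-0̂ = begin
      μ nothing                          ≡⟨ ℤP.+-identityʳ _ ⟨
      μ nothing +ℤ 0ℤ                    ≡⟨ cong (μ nothing +ℤ_) (ℤΣ.sum-zero {n} _ λ _ → refl) ⟨
      μ nothing +ℤ ℤΣ.sum {n} (λ _ → 0ℤ) ≡⟨ cong (μ nothing +ℤ_) (sumFin≡sum {n} _) ⟨
      μ nothing +ℤ sumFin {n} (λ _ → 0ℤ) ≡⟨ isMöbius nothing ⟩
      1ℤ                                 ∎
      where open ≡-Reasoning

    μ-recursion : (∀ {y} → y ≺ x → μ (just y) ≡ -[1+ 0 ]) → μ (just x) +ℤ 1ℤ ≡ + count (_≺? x)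
    μ-recursion {x} below-1 = begin
      μ (just x) +ℤ 1ℤ                   ≡⟨ cong (_+ℤ 1ℤ) split ⟨
      ℤΣ.sum F +ℤ below +ℤ 1ℤ            ≡⟨ rearrange (ℤΣ.sum F) below ⟩
      below +ℤ (1ℤ +ℤ ℤΣ.sum F)          ≡⟨ cong (λ t → below +ℤ (t +ℤ ℤΣ.sum F)) μ-0̂ ⟨
      below +ℤ (μ nothing +ℤ ℤΣ.sum F)   ≡⟨ cong (λ t → below +ℤ (μ nothing +ℤ t)) (sumFin≡sum F) ⟨
      below +ℤ (μ nothing +ℤ sumFin F)   ≡⟨ cong (below +ℤ_) (isMöbius (just x)) ⟩
      below +ℤ 0ℤ                        ≡⟨ ℤP.+-identityʳ below ⟩
      below                              ∎
      where
      open ≡-Reasoning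
      below : ℤ
      below = + count (_≺? x)
      F G : Fin n → ℤ
      F y = if ⌊ y ≤? x ⌋ then μ (just y) else 0ℤ
      G y = if ⌊ y ≟ x ⌋ then μ (just x) else 0ℤ
      F+below≡G : ∀ y → F y +ℤ + 𝟙 (y ≺? x) ≡ G y
      F+below≡G y with y ≟ x | y ≤? x
      ... | yes refl | yes _   = ℤP.+-identityʳ _
      ... | yes refl | no x⋠x  = ⊥-elim (x⋠x ≼-refl)
      ... | no y≢x   | yes y≼x = cong (_+ℤ 1ℤ) (below-1 (y≼x , y≢x))
      ... | no _     | no _    = refl
      split : ℤΣ.sum F +ℤ below ≡ μ (just x)
      split = begin
        ℤΣ.sum F +ℤ below                          ≡⟨ cong (ℤΣ.sum F +ℤ_) (sum-pos λ y → 𝟙 (y ≺? x)) ⟨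
        ℤΣ.sum F +ℤ ℤΣ.sum (λ y → + 𝟙 (y ≺? x))    ≡⟨ ℤΣ.∑-distrib-+ F (λ y → + 𝟙 (y ≺? x)) ⟨
        ℤΣ.sum (λ y → F y +ℤ + 𝟙 (y ≺? x))         ≡⟨ ℤΣ.sum-cong-≗ F+below≡G ⟩
        ℤΣ.sum G                                    ≡⟨ ℤΣ.sum-single G x G-off ⟩
        G x                                         ≡⟨ G-on ⟩
        μ (just x)                                  ∎
        where
        G-off : ∀ y → y ≢ x → G y ≡ 0ℤ
        G-off y y≢x with y ≟ x
        ... | yes y≡x = ⊥-elim (y≢x y≡x)
        ... | no _    = refl
        G-on : G x ≡ μ (just x)
        G-on with x ≟ x
        ... | yes _  = refl
        ... | no x≢x = ⊥-elim (x≢x refl)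
      rearrange : ∀ s c → s +ℤ c +ℤ 1ℤ ≡ c +ℤ (1ℤ +ℤ s)
      rearrange = solve-∀

    μ-minimal : Minimal x → μ (just x) ≡ -[1+ 0 ]
    μ-minimal {x} x-minimal = begin
      μ (just x)                  ≡⟨ add-sub-1 (μ (just x)) ⟩
      μ (just x) +ℤ 1ℤ +ℤ -[1+ 0 ] ≡⟨ cong (_+ℤ -[1+ 0 ]) (μ-recursion (⊥-elim ∘ nothing-below)) ⟩
      + count (_≺? x) +ℤ -[1+ 0 ]  ≡⟨ cong (λ k → + k +ℤ -[1+ 0 ]) no-count ⟩
      -[1+ 0 ]                     ∎
      where
      open ≡-Reasoning
      nothing-below : ∀ {y} → ¬ y ≺ x
      nothing-below (y≼x , y≢x) = y≢x (x-minimal _ y≼x)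
      no-count : count (_≺? x) ≡ 0
      no-count = ℕΣ.sum-zero _ λ y → 𝟙-no (y ≺? x) nothing-below
      add-sub-1 : ∀ a → a ≡ a +ℤ 1ℤ +ℤ -[1+ 0 ]
      add-sub-1 = solve-∀

    μ-InM : InM x → μ (just x) +ℤ 1ℤ ≡ + count (_≺? x)
    μ-InM inM = μ-recursion λ y≺x → μ-minimal (InM⇒below-minimal inM y≺x)

    sumOver+vertices≡edges : ∀ {C} → IsDownsetOfM C →
                             sumOver C μ +ℤ + Hasse.vertexCount C ≡ + Hasse.edgeCount C
    sumOver+vertices≡edges {C} downset = begin
      sumFin T +ℤ + Hasse.vertexCount C
        ≡⟨ cong₂ _+ℤ_ (sumFin≡sum T) (sym (sum-pos (λ x → 𝟙 (x ∈? C)))) ⟩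
      ℤΣ.sum T +ℤ ℤΣ.sum (λ x → + 𝟙 (x ∈? C))
        ≡⟨ ℤΣ.∑-distrib-+ T (λ x → + 𝟙 (x ∈? C)) ⟨
      ℤΣ.sum (λ x → T x +ℤ + 𝟙 (x ∈? C))
        ≡⟨ ℤΣ.sum-cong-≗ pointwise ⟩
      ℤΣ.sum (λ x → + (𝟙 (x ∈? C) * Hasse.inDegree C x))
        ≡⟨ sum-pos (λ x → 𝟙 (x ∈? C) * Hasse.inDegree C x) ⟩
      + Hasse.edgeCount C ∎
      where
      open ≡-Reasoning
      T : Fin n → ℤ
      T x = if ⌊ x ∈? C ⌋ then μ (just x) else 0ℤ
      pointwise : ∀ x → T x +ℤ + 𝟙 (x ∈? C) ≡ + (𝟙 (x ∈? C) * Hasse.inDegree C x)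
      pointwise x with x ∈? C
      ... | no _    = refl
      ... | yes x∈C = trans (μ-InM (proj₁ downset x x∈C))
                        (cong +_ (trans (sym (inDegree≡count-below downset x∈C)) (sym (+-identityʳ _))))

lemma5p6 : (P : FinPoset) → let open Notions P in
    (μ : P̂ → ℤ) → IsMobius μ →
    (C : Subset n) → Nonempty C → IsDownsetOfM C → Connected C →
    (sumOver C μ ≡ -[1+ 0 ] ⇔ IsTree C)
lemma5p6 P μ isMöbius C (r , r∈C) downset connected =
  mk⇔ (λ sum≡-1 → connected , to sum≡-1) (λ (_ , acyclic) → from acyclic)
  where
  open FinPosetFacts P
  open Möbius μ isMöbius
  open Equivalence
    (Hasse.edges+1≡vertices⇔acyclic (Connected⇒Hasse-Connected connected) r∈C
      ⇔-∘ ≡-1⇔+1≡ (Notions.sumOver P C μ) _ _ (sumOver+vertices≡edges downset))
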